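{- Let $N,k,v$ be positive integers with $v\ge 2$ and $k\ge 2$, and let $C$ be a uniform strength-$2$ covering array $\mathrm{UCA}(N;k,v)$. Let $d=\lfloor N/v\rfloor$ and $i=N-vd$. Then \[ (k^2-3k+2v)N^2 - v\bigl(k(2v-1)-2\bigr)(k-1)N + k\Bigl(k\bigl(v^4-v^3+vi-i^2\bigr) - \bigl(v^4-v^3+3vi-3i^2\bigr)\Bigr) \ge 0 . \] Moreover, if equality holds, then every pair of distinct rows of $C$ agree (have equal entries) in at least one and at most two columns.
   Context: A (strength-$2$) covering array $\mathrm{CA}(N;k,v)$ is an $N\times k$ array with entries from $\{0,1,\dots,v-1\}$ such that for every choice of two distinct columns $c,c'$ and every pair $(x,y)$ of symbols, there is at least one row $r$ with entry $x$ in column $c$ and entry $y$ in column $c'$. It is uniform, written $\mathrm{UCA}(N;k,v)$, if in every column every symbol occurs either $\lfloor N/v\rfloor$ or $\lceil N/v\rceil$ times. Two rows agree in a column if they have the same entry in that column. -}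

module Defs where

open import Data.Nat using (ℕ; zero; suc; _+_; _∸_; _≤_; NonZero)
open import Data.Nat.DivMod using (_/_)
open import Data.Bool using (Bool; true; false; if_then_else_)
open import Data.Fin using (Fin) renaming (zero to fzero; suc to fsuc)
import Data.Fin as F
open import Data.Product using (∃)
open import Data.Sum using (_⊎_)
open import Relation.Nullary using (¬_)
open import Relation.Nullary.Decidable using (⌊_⌋)
open import Relation.Binary.PropositionalEquality using (_≡_)

countFin : ∀ {n} → (Fin n → Bool) → ℕ
countFin {zero}  p = 0
countFin {suc n} p = (if p fzero then 1 else 0) + countFin (λ j → p (fsuc j))

-- an N × k array over the symbols {0,…,v-1}: rows indexed by Fin N, columns by Fin k
Array : ℕ → ℕ → ℕ → Set
Array N k v = Fin N → Fin k → Fin v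

IsCA : ∀ {N k v} → Array N k v → Set
IsCA {N} {k} {v} C =
  (c c' : Fin k) → ¬ (c ≡ c') → (x y : Fin v) →
  ∃ λ (r : Fin N) → (C r c ≡ x) × (C r c' ≡ y)
  where open import Data.Product using (_×_)

occ : ∀ {N k v} → Array N k v → Fin k → Fin v → ℕ
occ C c x = countFin (λ r → ⌊ C r c F.≟ x ⌋)

ceilDiv : (N v : ℕ) → .{{NonZero v}} → ℕ
ceilDiv N v = (N + (v ∸ 1)) / v

IsUniform : ∀ {N k v} .{{_ : NonZero v}} → Array N k v → Set
IsUniform {N} {k} {v} C =
  (c : Fin k) (x : Fin v) → (occ C c x ≡ N / v) ⊎ (occ C c x ≡ ceilDiv N v)

IsUCA : ∀ {N k v} .{{_ : NonZero v}} → Array N k v → Set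
IsUCA C = IsCA C × IsUniform C
  where open import Data.Product using (_×_)

agree : ∀ {N k v} → Array N k v → Fin N → Fin N → ℕ
agree C r r' = countFin (λ c → ⌊ C r c F.≟ C r' c ⌋)

module Submission where

-- Let a(r, s) be the number of columns in which rows r and s agree, so a(r, r) = k.
-- Double counting over columns gives Σ a = Σ_c Σ_x occ(c, x)², which uniformity fixes, and
-- Σ a² = Σ_{c,c'} Σ_{x,y} n_{cc'}(x, y)², where n_{cc'}(x, y) counts the rows reading x in
-- column c and y in column c'.  For c ≠ c' the covering property makes every n ≥ 1, and a
-- row of n's summing to o is then largest in square sum when all but one entry are 1; this
-- bounds Σ a² from above.  From below, a² + 2 = 3a + (a - 1)(a - 2) with (a - 1)(a - 2) ≥ 0
-- on ℕ and equal to (k - 1)(k - 2) on the N diagonal pairs.  Eliminating Σ a² between the two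
-- bounds shows that the discriminant is v times the sum of their slacks; if it vanishes,
-- (a - 1)(a - 2) = 0 for every pair of distinct rows, i.e. 1 ≤ a ≤ 2.

module Counting where

  open import Data.Bool using (Bool; if_then_else_)
  open import Data.Fin using (Fin; zero; suc; punchIn)
  open import Data.Fin.Properties using (_≟_; punchInᵢ≢i)
  open import Data.Nat using (ℕ; zero; suc; pred; NonZero; _+_; _*_; _∸_; _≤_; z≤n; s≤s)
  open import Data.Nat.DivMod using (_/_; m/n*n≤m; /-monoˡ-≤; m/n≡1+[m∸n]/n)
  open import Data.Nat.Properties as ℕ using (+-*-semiring; ≤-trans; +-mono-≤; +-monoˡ-≤; +-monoʳ-≤; m≤m+n; m≤n+m)
  open import Data.Nat.Tactic.RingSolver using (solve-∀)
  open import Algebra.Properties.CommutativeSemigroup ℕ.+-commutativeSemigroup using (xy∙z≈xz∙y)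
  open import Data.Product using (_,_; _×_)
  open import Data.Sum using (_⊎_; inj₁; inj₂)
  open import Function using (_∘_)
  open import Relation.Binary.PropositionalEquality
  open import Relation.Nullary using (yes; no; contradiction)
  open import Relation.Nullary.Decidable using (⌊_⌋; isYes≗does)
  open import Defs

  open import Algebra.Properties.Semiring.Sum +-*-semiring
    using (sum; sum-syntax; sum-remove; ∑-comm; ∑-distrib-+; *-distribˡ-sum; *-distribʳ-sum; sum-cong-≗; sum-replicate-zero)

  ∑-const : ∀ n c → ∑[ i < n ] c ≡ n * c
  ∑-const zero    c = refl
  ∑-const (suc n) c = cong (c +_) (∑-const n c)

  ∑-+-const : ∀ {n} (f : Fin n → ℕ) c → ∑[ i < n ] (f i + c) ≡ sum f + n * c
  ∑-+-const {n} f c = trans (∑-distrib-+ f (λ _ → c)) (cong (sum f +_) (∑-const n c))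

  ∑-affine : ∀ {n} (f g : Fin n → ℕ) a b → ∑[ i < n ] (f i + a * g i + b) ≡ sum f + (a * sum g + n * b)
  ∑-affine {n} f g a b = begin
    ∑[ i < n ] (f i + a * g i + b)           ≡⟨ ∑-+-const (λ i → f i + a * g i) b ⟩
    ∑[ i < n ] (f i + a * g i) + n * b       ≡⟨ cong (_+ n * b) (∑-distrib-+ f (λ i → a * g i)) ⟩
    sum f + ∑[ i < n ] (a * g i) + n * b     ≡⟨ cong (λ s → sum f + s + n * b) (*-distribˡ-sum a g) ⟨
    sum f + a * sum g + n * b                ≡⟨ ℕ.+-assoc (sum f) _ _ ⟩
    sum f + (a * sum g + n * b)              ∎
    where open ≡-Reasoning

  ∑-mono-≤ : ∀ {n} {f g : Fin n → ℕ} → (∀ i → f i ≤ g i) → sum f ≤ sum g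
  ∑-mono-≤ {zero}  f≤g = z≤n
  ∑-mono-≤ {suc n} f≤g = +-mono-≤ (f≤g zero) (∑-mono-≤ (f≤g ∘ suc))

  ∑-mono-≤-+ : ∀ {n} {f g : Fin n → ℕ} {e} (i : Fin n) →
    (∀ j → f j ≤ g j) → f i + e ≤ g i → sum f + e ≤ sum g
  ∑-mono-≤-+ {suc n} {f} {g} {e} zero f≤g fi+e≤gi = begin
    f zero + sum (f ∘ suc) + e  ≡⟨ xy∙z≈xz∙y (f zero) _ e ⟩
    f zero + e + sum (f ∘ suc)  ≤⟨ +-mono-≤ fi+e≤gi (∑-mono-≤ (f≤g ∘ suc)) ⟩
    g zero + sum (g ∘ suc)      ∎
    where open ℕ.≤-Reasoning
  ∑-mono-≤-+ {suc n} {f} {g} {e} (suc i) f≤g fi+e≤gi = begin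
    f zero + sum (f ∘ suc) + e    ≡⟨ ℕ.+-assoc (f zero) _ e ⟩
    f zero + (sum (f ∘ suc) + e)  ≤⟨ +-mono-≤ (f≤g zero) (∑-mono-≤-+ i (f≤g ∘ suc) fi+e≤gi) ⟩
    g zero + sum (g ∘ suc)        ∎
    where open ℕ.≤-Reasoning

  ∑-≤-off-diagonal : ∀ {n} (f : Fin n → ℕ) (i : Fin n) {a b} →
    (∀ j → j ≢ i → f j + a ≤ b) → sum f + pred n * a ≤ f i + pred n * b
  ∑-≤-off-diagonal {suc n} f i {a} {b} bound = begin
    sum f + n * a
      ≡⟨ cong (_+ n * a) (sum-remove {i = i} f) ⟩
    f i + ∑[ j < n ] f (punchIn i j) + n * a
      ≡⟨ ℕ.+-assoc (f i) _ _ ⟩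
    f i + (∑[ j < n ] f (punchIn i j) + n * a)
      ≡⟨ cong (f i +_) (∑-+-const (f ∘ punchIn i) a) ⟨
    f i + ∑[ j < n ] (f (punchIn i j) + a)
      ≤⟨ +-monoʳ-≤ (f i) (∑-mono-≤ (λ j → bound (punchIn i j) (punchInᵢ≢i i j))) ⟩
    f i + ∑[ j < n ] b
      ≡⟨ cong (f i +_) (∑-const n b) ⟩
    f i + n * b ∎
    where open ℕ.≤-Reasoning

  term-≤-∑ : ∀ {n} (f : Fin n → ℕ) (i : Fin n) → f i ≤ sum f
  term-≤-∑ f zero    = m≤m+n (f zero) _
  term-≤-∑ f (suc i) = ≤-trans (term-≤-∑ (f ∘ suc) i) (m≤n+m _ (f zero))

  two-terms-≤-∑ : ∀ {n} (f : Fin n → ℕ) {i j : Fin n} → i ≢ j → f i + f j ≤ sum f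
  two-terms-≤-∑ f {zero}  {zero}  i≢j = contradiction refl i≢j
  two-terms-≤-∑ f {zero}  {suc j} i≢j = +-monoʳ-≤ (f zero) (term-≤-∑ (f ∘ suc) j)
  two-terms-≤-∑ f {suc i} {zero}  i≢j =
    subst (_≤ sum f) (ℕ.+-comm (f zero) _) (+-monoʳ-≤ (f zero) (term-≤-∑ (f ∘ suc) i))
  two-terms-≤-∑ f {suc i} {suc j} i≢j =
    ≤-trans (two-terms-≤-∑ (f ∘ suc) (i≢j ∘ cong suc)) (m≤n+m _ (f zero))

  ∑-*-∑ : ∀ {m n} (f : Fin m → ℕ) (g : Fin n → ℕ) →
    sum f * sum g ≡ ∑[ i < m ] ∑[ j < n ] (f i * g j)
  ∑-*-∑ f g = trans (*-distribʳ-sum (sum g) f) (sum-cong-≗ (λ i → *-distribˡ-sum (f i) g))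

  ∑-sq-≤-sq-∑ : ∀ {n} (f : Fin n → ℕ) → ∑[ i < n ] (f i * f i) ≤ sum f * sum f
  ∑-sq-≤-sq-∑ {zero}  f = z≤n
  ∑-sq-≤-sq-∑ {suc n} f = begin
    f₀ * f₀ + ∑[ i < n ] (f (suc i) * f (suc i))
      ≤⟨ +-monoʳ-≤ (f₀ * f₀) (∑-sq-≤-sq-∑ (f ∘ suc)) ⟩
    f₀ * f₀ + s * s
      ≤⟨ m≤m+n _ (2 * (f₀ * s)) ⟩
    f₀ * f₀ + s * s + 2 * (f₀ * s)
      ≡⟨ square-+ f₀ s ⟩
    (f₀ + s) * (f₀ + s) ∎
    where
    open ℕ.≤-Reasoning
    f₀ s : ℕ
    f₀ = f zero
    s = sum (f ∘ suc)
    square-+ : ∀ a b → a * a + b * b + 2 * (a * b) ≡ (a + b) * (a + b)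
    square-+ = solve-∀

  -- Σ fᵢ² ≤ (S - n + 1)² + (n - 1) for positive fᵢ with sum S, rearranged to avoid subtraction.
  ∑-sq-≤-of-positive : ∀ {n} (f : Fin n → ℕ) → (∀ i → 1 ≤ f i) →
    ∑[ i < n ] (f i * f i) + 2 * n * sum f + n ≤ sum f * sum f + 2 * sum f + n * n
  ∑-sq-≤-of-positive {n} f f≥1 = begin
    ∑[ i < n ] (f i * f i) + 2 * n * sum f + n
      ≡⟨ cong₂ (λ q s → q + 2 * n * s + n) ∑-sq-f ∑-f ⟩
    ∑t² + 2 * T + n * 1 + 2 * n * (T + n * 1) + n
      ≡⟨ regroup ∑t² T n ⟩
    ∑t² + R
      ≤⟨ +-monoˡ-≤ R (∑-sq-≤-sq-∑ t) ⟩
    T * T + R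
      ≡⟨ expand T n ⟩
    (T + n * 1) * (T + n * 1) + 2 * (T + n * 1) + n * n
      ≡⟨ cong (λ s → s * s + 2 * s + n * n) (sym ∑-f) ⟩
    sum f * sum f + 2 * sum f + n * n ∎
    where
    open ℕ.≤-Reasoning
    t : Fin n → ℕ
    t i = f i ∸ 1
    f≡t+1 : ∀ i → f i ≡ t i + 1
    f≡t+1 i = sym (ℕ.m∸n+n≡m (f≥1 i))
    T ∑t² R : ℕ
    T = sum t
    ∑t² = ∑[ i < n ] (t i * t i)
    R = 2 * T + n * 1 + (2 * n * (T + n * 1) + n)
    ∑-f : sum f ≡ T + n * 1
    ∑-f = trans (sum-cong-≗ f≡t+1) (∑-+-const t 1)
    square-+1 : ∀ a → (a + 1) * (a + 1) ≡ a * a + 2 * a + 1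
    square-+1 = solve-∀
    ∑-sq-f : ∑[ i < n ] (f i * f i) ≡ ∑t² + 2 * T + n * 1
    ∑-sq-f = begin-equality
      ∑[ i < n ] (f i * f i)
        ≡⟨ sum-cong-≗ (λ i → trans (cong₂ _*_ (f≡t+1 i) (f≡t+1 i)) (square-+1 (t i))) ⟩
      ∑[ i < n ] (t i * t i + 2 * t i + 1)
        ≡⟨ ∑-+-const (λ i → t i * t i + 2 * t i) 1 ⟩
      ∑[ i < n ] (t i * t i + 2 * t i) + n * 1
        ≡⟨ cong (_+ n * 1) (∑-distrib-+ (λ i → t i * t i) (λ i → 2 * t i)) ⟩
      ∑t² + ∑[ i < n ] (2 * t i) + n * 1
        ≡⟨ cong (λ x → ∑t² + x + n * 1) (sym (*-distribˡ-sum 2 t)) ⟩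
      ∑t² + 2 * T + n * 1 ∎
    regroup : ∀ q T n → q + 2 * T + n * 1 + 2 * n * (T + n * 1) + n
                      ≡ q + (2 * T + n * 1 + (2 * n * (T + n * 1) + n))
    regroup = solve-∀
    expand : ∀ T n → T * T + (2 * T + n * 1 + (2 * n * (T + n * 1) + n))
                   ≡ (T + n * 1) * (T + n * 1) + 2 * (T + n * 1) + n * n
    expand = solve-∀

  ∑∑-∑-comm : ∀ {n m} (F : Fin n → Fin n → Fin m → ℕ) →
    ∑[ r < n ] ∑[ s < n ] ∑[ z < m ] F r s z ≡ ∑[ z < m ] ∑[ r < n ] ∑[ s < n ] F r s z
  ∑∑-∑-comm F = trans (sum-cong-≗ (λ r → ∑-comm (F r))) (∑-comm (λ r z → ∑[ s < _ ] F r s z))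

  ∑∑-∑-*≡∑-square : ∀ {n m} (h : Fin n → Fin m → ℕ) →
    ∑[ r < n ] ∑[ s < n ] ∑[ z < m ] (h r z * h s z) ≡
    ∑[ z < m ] (∑[ r < n ] h r z * ∑[ s < n ] h s z)
  ∑∑-∑-*≡∑-square h = trans (∑∑-∑-comm (λ r s z → h r z * h s z))
    (sum-cong-≗ (λ z → sym (∑-*-∑ (λ r → h r z) (λ s → h s z))))

  δ : ∀ {n} → Fin n → Fin n → ℕ
  δ a b = if ⌊ a ≟ b ⌋ then 1 else 0

  δ-refl : ∀ {n} (a : Fin n) → δ a a ≡ 1
  δ-refl a with a ≟ a
  ... | yes _   = refl
  ... | no a≢a = contradiction refl a≢a

  δ-sym : ∀ {n} (a b : Fin n) → δ a b ≡ δ b a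
  δ-sym a b with a ≟ b | b ≟ a
  ... | yes _   | yes _   = refl
  ... | no _    | no _    = refl
  ... | yes a≡b | no b≢a  = contradiction (sym a≡b) b≢a
  ... | no a≢b  | yes b≡a = contradiction (sym b≡a) a≢b

  δ-idem : ∀ {n} (a b : Fin n) → δ a b * δ a b ≡ δ a b
  δ-idem a b with a ≟ b
  ... | yes _ = refl
  ... | no _  = refl

  δ-suc : ∀ {n} (a b : Fin n) → δ (suc a) (suc b) ≡ δ a b
  δ-suc a b = cong (λ β → if β then 1 else 0) (trans (isYes≗does (suc a ≟ suc b)) (sym (isYes≗does (a ≟ b))))

  ∑-δ-* : ∀ {n} (a : Fin n) (f : Fin n → ℕ) → ∑[ x < n ] (δ a x * f x) ≡ f a
  ∑-δ-* {suc n} zero f = begin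
    1 * f zero + ∑[ x < n ] 0 ≡⟨ cong₂ _+_ (ℕ.*-identityˡ (f zero)) (sum-replicate-zero n) ⟩
    f zero + 0                ≡⟨ ℕ.+-identityʳ (f zero) ⟩
    f zero                    ∎
    where open ≡-Reasoning
  ∑-δ-* {suc n} (suc a) f = trans (sum-cong-≗ (λ x → cong (_* f (suc x)) (δ-suc a x))) (∑-δ-* a (f ∘ suc))

  δ≡∑-δ-* : ∀ {n} (a b : Fin n) → δ a b ≡ ∑[ x < n ] (δ a x * δ b x)
  δ≡∑-δ-* a b = trans (δ-sym a b) (sym (∑-δ-* a (δ b)))

  countFin≡∑ : ∀ {n} (p : Fin n → Bool) → countFin p ≡ ∑[ j < n ] (if p j then 1 else 0)
  countFin≡∑ {zero}  p = refl
  countFin≡∑ {suc n} p = cong ((if p zero then 1 else 0) +_) (countFin≡∑ (p ∘ suc))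

  ∑-δ : ∀ {n} (a : Fin n) → ∑[ x < n ] δ a x ≡ 1
  ∑-δ a = trans (sum-cong-≗ (λ x → sym (ℕ.*-identityʳ (δ a x)))) (∑-δ-* a (λ _ → 1))

  -- (a - 1)(a - 2); the case a = 0 is separate because ∸ truncates.
  excess : ℕ → ℕ
  excess zero    = 2
  excess (suc a) = a * (a ∸ 1)

  a*a+2≡3*a+excess : ∀ a → a * a + 2 ≡ 3 * a + excess a
  a*a+2≡3*a+excess zero          = refl
  a*a+2≡3*a+excess (suc zero)    = refl
  a*a+2≡3*a+excess (suc (suc a)) = expand a
    where
    expand : ∀ a → (2 + a) * (2 + a) + 2 ≡ 3 * (2 + a) + (1 + a) * a
    expand = solve-∀

  excess≡0⇒1≤∧≤2 : ∀ a → excess a ≡ 0 → 1 ≤ a × a ≤ 2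
  excess≡0⇒1≤∧≤2 (suc zero)       _ = s≤s z≤n , s≤s z≤n
  excess≡0⇒1≤∧≤2 (suc (suc zero)) _ = s≤s z≤n , s≤s (s≤s z≤n)

  o*o+d*[d+1]≡[2d+1]*o : ∀ d o → o ≡ d ⊎ o ≡ suc d → o * o + d * (d + 1) ≡ (2 * d + 1) * o
  o*o+d*[d+1]≡[2d+1]*o d o (inj₁ refl) = identity d
    where
    identity : ∀ d → d * d + d * (d + 1) ≡ (2 * d + 1) * d
    identity = solve-∀
  o*o+d*[d+1]≡[2d+1]*o d o (inj₂ refl) = identity d
    where
    identity : ∀ d → suc d * suc d + d * (d + 1) ≡ (2 * d + 1) * suc d
    identity = solve-∀

  m*[n/m]+[n∸m*[n/m]]≡n : ∀ m n .{{_ : NonZero m}} → m * (n / m) + (n ∸ m * (n / m)) ≡ n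
  m*[n/m]+[n∸m*[n/m]]≡n m n = ℕ.m+[n∸m]≡n (subst (_≤ n) (ℕ.*-comm (n / m) m) (m/n*n≤m n m))

  ceilDiv≡/⊎≡1+/ : ∀ N v .{{_ : NonZero v}} → ceilDiv N v ≡ N / v ⊎ ceilDiv N v ≡ suc (N / v)
  ceilDiv≡/⊎≡1+/ N v with ℕ.m≤n⇒m<n∨m≡n (/-monoˡ-≤ v (m≤m+n N (v ∸ 1)))
  ... | inj₂ eq = inj₁ (sym eq)
  ... | inj₁ lt = inj₂ (ℕ.≤-antisym ceilDiv≤1+/ lt)
    where
    ceilDiv≤1+/ : ceilDiv N v ≤ suc (N / v)
    ceilDiv≤1+/ = begin
      (N + (v ∸ 1)) / v   ≤⟨ /-monoˡ-≤ v (+-monoʳ-≤ N (ℕ.m∸n≤m v 1)) ⟩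
      (N + v) / v         ≡⟨ m/n≡1+[m∸n]/n (m≤n+m v N) ⟩
      1 + (N + v ∸ v) / v ≡⟨ cong (λ m → 1 + m / v) (ℕ.m+n∸n≡m N v) ⟩
      suc (N / v)         ∎
      where open ℕ.≤-Reasoning

  -- Agreement counts of an array

  module Agreement {N k v : ℕ} (C : Array N k v) where

    occ≡∑ : ∀ c x → occ C c x ≡ ∑[ r < N ] δ (C r c) x
    occ≡∑ c x = countFin≡∑ (λ r → ⌊ C r c ≟ x ⌋)

    agree≡∑ : ∀ r s → agree C r s ≡ ∑[ c < k ] δ (C r c) (C s c)
    agree≡∑ r s = countFin≡∑ (λ c → ⌊ C r c ≟ C s c ⌋)

    ∑-occ : ∀ c → ∑[ x < v ] occ C c x ≡ N
    ∑-occ c = begin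
      ∑[ x < v ] occ C c x                ≡⟨ sum-cong-≗ (occ≡∑ c) ⟩
      ∑[ x < v ] ∑[ r < N ] δ (C r c) x  ≡⟨ ∑-comm (λ x r → δ (C r c) x) ⟩
      ∑[ r < N ] ∑[ x < v ] δ (C r c) x  ≡⟨ sum-cong-≗ (λ r → ∑-δ (C r c)) ⟩
      ∑[ r < N ] 1                        ≡⟨ ∑-const N 1 ⟩
      N * 1                               ≡⟨ ℕ.*-identityʳ N ⟩
      N                                   ∎
      where open ≡-Reasoning

    colSq : Fin k → ℕ
    colSq c = ∑[ x < v ] (occ C c x * occ C c x)

    ∑∑-δ≡colSq : ∀ c → ∑[ r < N ] ∑[ s < N ] δ (C r c) (C s c) ≡ colSq c
    ∑∑-δ≡colSq c = begin
      ∑[ r < N ] ∑[ s < N ] δ (C r c) (C s c)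
        ≡⟨ sum-cong-≗ (λ r → sum-cong-≗ (λ s → δ≡∑-δ-* (C r c) (C s c))) ⟩
      ∑[ r < N ] ∑[ s < N ] ∑[ x < v ] (δ (C r c) x * δ (C s c) x)
        ≡⟨ ∑∑-∑-*≡∑-square (λ r x → δ (C r c) x) ⟩
      ∑[ x < v ] (∑[ r < N ] δ (C r c) x * ∑[ s < N ] δ (C s c) x)
        ≡⟨ sum-cong-≗ (λ x → sym (cong₂ _*_ (occ≡∑ c x) (occ≡∑ c x))) ⟩
      colSq c ∎
      where open ≡-Reasoning

    pairCount : Fin k → Fin k → Fin v → Fin v → ℕ
    pairCount c c' x y = ∑[ r < N ] (δ (C r c) x * δ (C r c') y)

    bothAgree : Fin k → Fin k → ℕ
    bothAgree c c' = ∑[ r < N ] ∑[ s < N ] (δ (C r c) (C s c) * δ (C r c') (C s c'))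

    bothAgree-diag : ∀ c → bothAgree c c ≡ colSq c
    bothAgree-diag c = trans (sum-cong-≗ (λ r → sum-cong-≗ (λ s → δ-idem (C r c) (C s c)))) (∑∑-δ≡colSq c)

    bothAgree≡∑-pairCount² : ∀ c c' →
      bothAgree c c' ≡ ∑[ x < v ] ∑[ y < v ] (pairCount c c' x y * pairCount c c' x y)
    bothAgree≡∑-pairCount² c c' = begin
      bothAgree c c'
        ≡⟨ sum-cong-≗ (λ r → sum-cong-≗ (δδ≡∑∑ r)) ⟩
      ∑[ r < N ] ∑[ s < N ] ∑[ x < v ] ∑[ y < v ] (H r x y * H s x y)
        ≡⟨ ∑∑-∑-comm (λ r s x → ∑[ y < v ] (H r x y * H s x y)) ⟩
      ∑[ x < v ] ∑[ r < N ] ∑[ s < N ] ∑[ y < v ] (H r x y * H s x y)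
        ≡⟨ sum-cong-≗ (λ x → ∑∑-∑-*≡∑-square (λ r y → H r x y)) ⟩
      ∑[ x < v ] ∑[ y < v ] (pairCount c c' x y * pairCount c c' x y) ∎
      where
      open ≡-Reasoning
      H : Fin N → Fin v → Fin v → ℕ
      H r x y = δ (C r c) x * δ (C r c') y
      interchange : ∀ a b e f → a * b * (e * f) ≡ a * e * (b * f)
      interchange = solve-∀
      δδ≡∑∑ : ∀ r s → δ (C r c) (C s c) * δ (C r c') (C s c') ≡ ∑[ x < v ] ∑[ y < v ] (H r x y * H s x y)
      δδ≡∑∑ r s = begin
        δ (C r c) (C s c) * δ (C r c') (C s c')
          ≡⟨ cong₂ _*_ (δ≡∑-δ-* (C r c) (C s c)) (δ≡∑-δ-* (C r c') (C s c')) ⟩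
        ∑[ x < v ] (δ (C r c) x * δ (C s c) x) * ∑[ y < v ] (δ (C r c') y * δ (C s c') y)
          ≡⟨ ∑-*-∑ (λ x → δ (C r c) x * δ (C s c) x) (λ y → δ (C r c') y * δ (C s c') y) ⟩
        ∑[ x < v ] ∑[ y < v ] (δ (C r c) x * δ (C s c) x * (δ (C r c') y * δ (C s c') y))
          ≡⟨ sum-cong-≗ (λ x → sum-cong-≗ (λ y →
               interchange (δ (C r c) x) (δ (C s c) x) (δ (C r c') y) (δ (C s c') y))) ⟩
        ∑[ x < v ] ∑[ y < v ] (H r x y * H s x y) ∎

    ∑-pairCount : ∀ c c' x → ∑[ y < v ] pairCount c c' x y ≡ occ C c x
    ∑-pairCount c c' x = begin
      ∑[ y < v ] ∑[ r < N ] (δ (C r c) x * δ (C r c') y)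
        ≡⟨ ∑-comm (λ y r → δ (C r c) x * δ (C r c') y) ⟩
      ∑[ r < N ] ∑[ y < v ] (δ (C r c) x * δ (C r c') y)
        ≡⟨ sum-cong-≗ (λ r → sym (*-distribˡ-sum (δ (C r c) x) (δ (C r c')))) ⟩
      ∑[ r < N ] (δ (C r c) x * ∑[ y < v ] δ (C r c') y)
        ≡⟨ sum-cong-≗ (λ r → cong (δ (C r c) x *_) (∑-δ (C r c'))) ⟩
      ∑[ r < N ] (δ (C r c) x * 1)
        ≡⟨ sum-cong-≗ (λ r → ℕ.*-identityʳ (δ (C r c) x)) ⟩
      ∑[ r < N ] δ (C r c) x
        ≡⟨ occ≡∑ c x ⟨
      occ C c x ∎
      where open ≡-Reasoning

    pairCount-pos : IsCA C → ∀ {c c'} → c ≢ c' → ∀ x y → 1 ≤ pairCount c c' x y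
    pairCount-pos isCA {c} {c'} c≢c' x y with isCA c c' c≢c' x y
    ... | r , refl , refl = subst (_≤ pairCount c c' x y) (cong₂ _*_ (δ-refl x) (δ-refl y))
                                  (term-≤-∑ (λ r → δ (C r c) x * δ (C r c') y) r)

    bothAgree-bound : IsCA C → ∀ {c c'} → c ≢ c' →
      bothAgree c c' + (2 * v * N + v * v) ≤ colSq c + (2 * N + v * (v * v))
    bothAgree-bound isCA {c} {c'} c≢c' = begin
      bothAgree c c' + (2 * v * N + v * v)
        ≡⟨ cong₂ (λ b n → b + (2 * v * n + v * v)) (bothAgree≡∑-pairCount² c c') (sym (∑-occ c)) ⟩
      ∑[ x < v ] ∑pc² x + (2 * v * ∑[ x < v ] o x + v * v)
        ≡⟨ ∑-affine ∑pc² o (2 * v) v ⟨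
      ∑[ x < v ] (∑pc² x + 2 * v * o x + v)
        ≤⟨ ∑-mono-≤ row-bound ⟩
      ∑[ x < v ] (o x * o x + 2 * o x + v * v)
        ≡⟨ ∑-affine (λ x → o x * o x) o 2 (v * v) ⟩
      colSq c + (2 * ∑[ x < v ] o x + v * (v * v))
        ≡⟨ cong (λ n → colSq c + (2 * n + v * (v * v))) (∑-occ c) ⟩
      colSq c + (2 * N + v * (v * v)) ∎
      where
      open ℕ.≤-Reasoning
      o : Fin v → ℕ
      o = occ C c
      ∑pc² : Fin v → ℕ
      ∑pc² x = ∑[ y < v ] (pairCount c c' x y * pairCount c c' x y)
      row-bound : ∀ x → ∑pc² x + 2 * v * o x + v ≤ o x * o x + 2 * o x + v * v
      row-bound x = subst (λ n → ∑pc² x + 2 * v * n + v ≤ n * n + 2 * n + v * v) (∑-pairCount c c' x)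
        (∑-sq-≤-of-positive (pairCount c c' x) (pairCount-pos isCA c≢c' x))

    agreeSum agreeSqSum : ℕ
    agreeSum = ∑[ r < N ] ∑[ s < N ] agree C r s
    agreeSqSum = ∑[ r < N ] ∑[ s < N ] (agree C r s * agree C r s)

    agreeSum≡∑-colSq : agreeSum ≡ ∑[ c < k ] colSq c
    agreeSum≡∑-colSq = begin
      agreeSum
        ≡⟨ sum-cong-≗ (λ r → sum-cong-≗ (agree≡∑ r)) ⟩
      ∑[ r < N ] ∑[ s < N ] ∑[ c < k ] δ (C r c) (C s c)
        ≡⟨ ∑∑-∑-comm (λ r s c → δ (C r c) (C s c)) ⟩
      ∑[ c < k ] ∑[ r < N ] ∑[ s < N ] δ (C r c) (C s c)
        ≡⟨ sum-cong-≗ ∑∑-δ≡colSq ⟩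
      ∑[ c < k ] colSq c ∎
      where open ≡-Reasoning

    agreeSqSum≡∑∑-bothAgree : agreeSqSum ≡ ∑[ c < k ] ∑[ c' < k ] bothAgree c c'
    agreeSqSum≡∑∑-bothAgree = begin
      agreeSqSum
        ≡⟨ sum-cong-≗ (λ r → sum-cong-≗ (agree²≡∑∑ r)) ⟩
      ∑[ r < N ] ∑[ s < N ] ∑[ c < k ] ∑[ c' < k ] F r s c c'
        ≡⟨ ∑∑-∑-comm (λ r s c → ∑[ c' < k ] F r s c c') ⟩
      ∑[ c < k ] ∑[ r < N ] ∑[ s < N ] ∑[ c' < k ] F r s c c'
        ≡⟨ sum-cong-≗ (λ c → ∑∑-∑-comm (λ r s → F r s c)) ⟩
      ∑[ c < k ] ∑[ c' < k ] bothAgree c c' ∎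
      where
      open ≡-Reasoning
      F : Fin N → Fin N → Fin k → Fin k → ℕ
      F r s c c' = δ (C r c) (C s c) * δ (C r c') (C s c')
      agree²≡∑∑ : ∀ r s → agree C r s * agree C r s ≡ ∑[ c < k ] ∑[ c' < k ] F r s c c'
      agree²≡∑∑ r s = trans (cong₂ _*_ (agree≡∑ r s) (agree≡∑ r s))
        (∑-*-∑ (λ c → δ (C r c) (C s c)) (λ c' → δ (C r c') (C s c')))

    agreeSqSum-bound : IsCA C →
      agreeSqSum + k * (pred k * (2 * v * N + v * v)) ≤ agreeSum + pred k * (agreeSum + k * (2 * N + v * (v * v)))
    agreeSqSum-bound isCA = begin
      agreeSqSum + k * (pred k * X)
        ≡⟨ cong (_+ k * (pred k * X)) agreeSqSum≡∑∑-bothAgree ⟩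
      ∑[ c < k ] ∑[ c' < k ] bothAgree c c' + k * (pred k * X)
        ≡⟨ ∑-+-const (λ c → ∑[ c' < k ] bothAgree c c') (pred k * X) ⟨
      ∑[ c < k ] (∑[ c' < k ] bothAgree c c' + pred k * X)
        ≤⟨ ∑-mono-≤ row-bound ⟩
      ∑[ c < k ] (colSq c + pred k * (colSq c + K))
        ≡⟨ ∑-distrib-+ colSq (λ c → pred k * (colSq c + K)) ⟩
      sum colSq + ∑[ c < k ] (pred k * (colSq c + K))
        ≡⟨ cong (sum colSq +_) (*-distribˡ-sum (pred k) (λ c → colSq c + K)) ⟨
      sum colSq + pred k * ∑[ c < k ] (colSq c + K)
        ≡⟨ cong (λ q → sum colSq + pred k * q) (∑-+-const colSq K) ⟩
      sum colSq + pred k * (sum colSq + k * K)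
        ≡⟨ cong (λ q → q + pred k * (q + k * K)) agreeSum≡∑-colSq ⟨
      agreeSum + pred k * (agreeSum + k * K) ∎
      where
      open ℕ.≤-Reasoning
      X K : ℕ
      X = 2 * v * N + v * v
      K = 2 * N + v * (v * v)
      row-bound : ∀ c → ∑[ c' < k ] bothAgree c c' + pred k * X ≤ colSq c + pred k * (colSq c + K)
      row-bound c = subst (λ q → ∑[ c' < k ] bothAgree c c' + pred k * X ≤ q + pred k * (colSq c + K))
        (bothAgree-diag c)
        (∑-≤-off-diagonal (bothAgree c) c (λ c' c'≢c → bothAgree-bound isCA (c'≢c ∘ sym)))

    agree-diag : ∀ r → agree C r r ≡ k
    agree-diag r = begin
      agree C r r                   ≡⟨ agree≡∑ r r ⟩
      ∑[ c < k ] δ (C r c) (C r c)  ≡⟨ sum-cong-≗ (λ c → δ-refl (C r c)) ⟩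
      ∑[ c < k ] 1                  ≡⟨ ∑-const k 1 ⟩
      k * 1                         ≡⟨ ℕ.*-identityʳ k ⟩
      k                             ∎
      where open ≡-Reasoning

    excessSum : ℕ
    excessSum = ∑[ r < N ] ∑[ s < N ] excess (agree C r s)

    agreeSqSum-excess : agreeSqSum + N * (N * 2) ≡ 3 * agreeSum + excessSum
    agreeSqSum-excess = begin
      agreeSqSum + N * (N * 2)
        ≡⟨ ∑-+-const (λ r → ∑[ s < N ] (a r s * a r s)) (N * 2) ⟨
      ∑[ r < N ] (∑[ s < N ] (a r s * a r s) + N * 2)
        ≡⟨ sum-cong-≗ (λ r → ∑-+-const (λ s → a r s * a r s) 2) ⟨
      ∑[ r < N ] ∑[ s < N ] (a r s * a r s + 2)
        ≡⟨ sum-cong-≗ (λ r → sum-cong-≗ (λ s → a*a+2≡3*a+excess (a r s))) ⟩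
      ∑[ r < N ] ∑[ s < N ] (3 * a r s + excess (a r s))
        ≡⟨ sum-cong-≗ (λ r → ∑-distrib-+ (λ s → 3 * a r s) (λ s → excess (a r s))) ⟩
      ∑[ r < N ] (∑[ s < N ] (3 * a r s) + ∑[ s < N ] excess (a r s))
        ≡⟨ sum-cong-≗ (λ r → cong (_+ ∑[ s < N ] excess (a r s)) (*-distribˡ-sum 3 (a r))) ⟨
      ∑[ r < N ] (3 * ∑[ s < N ] a r s + ∑[ s < N ] excess (a r s))
        ≡⟨ ∑-distrib-+ (λ r → 3 * ∑[ s < N ] a r s) _ ⟩
      ∑[ r < N ] (3 * ∑[ s < N ] a r s) + excessSum
        ≡⟨ cong (_+ excessSum) (*-distribˡ-sum 3 (λ r → ∑[ s < N ] a r s)) ⟨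
      3 * agreeSum + excessSum ∎
      where
      open ≡-Reasoning
      a : Fin N → Fin N → ℕ
      a = agree C

    excess-row-≥ : ∀ r → excess k ≤ ∑[ s < N ] excess (agree C r s)
    excess-row-≥ r = subst (_≤ ∑[ s < N ] excess (agree C r s)) (cong excess (agree-diag r))
      (term-≤-∑ (excess ∘ agree C r) r)

    excessSum-≥ : N * excess k ≤ excessSum
    excessSum-≥ = subst (_≤ excessSum) (∑-const N (excess k)) (∑-mono-≤ excess-row-≥)

    excessSum-tight : excessSum ≡ N * excess k → ∀ {r s} → r ≢ s → excess (agree C r s) ≡ 0
    excessSum-tight tight {r} {s} r≢s = ℕ.n≤0⇒n≡0 (ℕ.+-cancelˡ-≤ (N * excess k) _ _ (begin
      N * excess k + excess (agree C r s)           ≡⟨ cong (_+ excess (agree C r s)) (∑-const N (excess k)) ⟨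
      ∑[ r < N ] excess k + excess (agree C r s)    ≤⟨ ∑-mono-≤-+ r excess-row-≥ diag+off ⟩
      excessSum                                     ≡⟨ tight ⟩
      N * excess k                                  ≡⟨ ℕ.+-identityʳ _ ⟨
      N * excess k + 0                              ∎))
      where
      open ℕ.≤-Reasoning
      diag+off : excess k + excess (agree C r s) ≤ ∑[ s < N ] excess (agree C r s)
      diag+off = subst (λ e → e + excess (agree C r s) ≤ ∑[ s < N ] excess (agree C r s)) (cong excess (agree-diag r))
        (two-terms-≤-∑ (excess ∘ agree C r) r≢s)

    module _ {d : ℕ} (occ-near-d : ∀ c x → occ C c x ≡ d ⊎ occ C c x ≡ suc d) where

      colSq-near-d : ∀ c → colSq c + v * (d * (d + 1)) ≡ (2 * d + 1) * N
      colSq-near-d c = begin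
        colSq c + v * (d * (d + 1))
          ≡⟨ ∑-+-const (λ x → occ C c x * occ C c x) (d * (d + 1)) ⟨
        ∑[ x < v ] (occ C c x * occ C c x + d * (d + 1))
          ≡⟨ sum-cong-≗ (λ x → o*o+d*[d+1]≡[2d+1]*o d (occ C c x) (occ-near-d c x)) ⟩
        ∑[ x < v ] ((2 * d + 1) * occ C c x)
          ≡⟨ *-distribˡ-sum (2 * d + 1) (occ C c) ⟨
        (2 * d + 1) * ∑[ x < v ] occ C c x
          ≡⟨ cong ((2 * d + 1) *_) (∑-occ c) ⟩
        (2 * d + 1) * N ∎
        where open ≡-Reasoning

      agreeSum-near-d : agreeSum + k * (v * (d * (d + 1))) ≡ k * ((2 * d + 1) * N)
      agreeSum-near-d = begin
        agreeSum + k * (v * (d * (d + 1)))         ≡⟨ cong (_+ k * (v * (d * (d + 1)))) agreeSum≡∑-colSq ⟩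
        sum colSq + k * (v * (d * (d + 1)))        ≡⟨ ∑-+-const colSq (v * (d * (d + 1))) ⟨
        ∑[ c < k ] (colSq c + v * (d * (d + 1)))  ≡⟨ sum-cong-≗ colSq-near-d ⟩
        ∑[ c < k ] ((2 * d + 1) * N)               ≡⟨ ∑-const k ((2 * d + 1) * N) ⟩
        k * ((2 * d + 1) * N)                      ∎
        where open ≡-Reasoning

    occ-near-/ : ∀ .{{_ : NonZero v}} → IsUniform C → ∀ c x → occ C c x ≡ N / v ⊎ occ C c x ≡ suc (N / v)
    occ-near-/ uniform c x with uniform c x | ceilDiv≡/⊎≡1+/ N v
    ... | inj₁ o≡/ | _         = inj₁ o≡/
    ... | inj₂ o≡⌈⌉ | inj₁ ⌈⌉≡/ = inj₁ (trans o≡⌈⌉ ⌈⌉≡/)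
    ... | inj₂ o≡⌈⌉ | inj₂ ⌈⌉≡1+/ = inj₂ (trans o≡⌈⌉ ⌈⌉≡1+/)

    squareSlack excessSlack : ℕ
    squareSlack = agreeSum + pred k * (agreeSum + k * (2 * N + v * (v * v)))
                  ∸ (agreeSqSum + k * (pred k * (2 * v * N + v * v)))
    excessSlack = excessSum ∸ N * excess k

    agreeSqSum+squareSlack : IsCA C →
      agreeSqSum + k * (pred k * (2 * v * N + v * v)) + squareSlack
      ≡ agreeSum + pred k * (agreeSum + k * (2 * N + v * (v * v)))
    agreeSqSum+squareSlack isCA = ℕ.m+[n∸m]≡n (agreeSqSum-bound isCA)

    excessSum≡+excessSlack : N * excess k + excessSlack ≡ excessSum
    excessSum≡+excessSlack = ℕ.m+[n∸m]≡n excessSum-≥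

    excessSlack≡0⇒agree-1-2 : excessSlack ≡ 0 → ∀ {r s} → r ≢ s → 1 ≤ agree C r s × agree C r s ≤ 2
    excessSlack≡0⇒agree-1-2 slack≡0 {r} {s} r≢s = excess≡0⇒1≤∧≤2 (agree C r s) (excessSum-tight tight r≢s)
      where
      tight : excessSum ≡ N * excess k
      tight = trans (sym excessSum≡+excessSlack) (trans (cong (N * excess k +_) slack≡0) (ℕ.+-identityʳ _))

open import Defs
open import Data.Nat using (ℕ; suc; _≤_; _∸_; NonZero)
open import Data.Nat.DivMod using (_/_)
open import Data.Integer using (ℤ; +_; _+_; _-_; _*_; _≥_)
open import Data.Fin using (Fin)
open import Data.Product using (_×_)
open import Relation.Nullary using (¬_)
open import Relation.Binary.PropositionalEquality using (_≡_)

import Data.Nat.Properties as ℕ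
import Data.Integer.Properties as ℤ
open import Data.Integer.Tactic.RingSolver using (solve; solve-∀)
open import Data.List using (_∷_; [])
open import Data.Product using (_,_)
open import Relation.Binary.PropositionalEquality using (refl; sym; trans; cong; cong₂; subst)
open Counting using (m*[n/m]+[n∸m*[n/m]]≡n; excess; a*a+2≡3*a+excess; module Agreement)

-- The discriminant as a sum of slacks

discriminant : ℤ → ℤ → ℤ → ℤ → ℤ
discriminant N k v i =
  (k * k - + 3 * k + + 2 * v) * N * N
  - v * (k * (+ 2 * v - + 1) - + 2) * (k - + 1) * N
  + k * (k * (v * v * v * v - v * v * v + v * i - i * i)
         - (v * v * v * v - v * v * v + + 3 * v * i - + 3 * i * i))

discriminant-identity : ∀ (N k k₁ v i d L P E g D₁ D₂ : ℤ) →
  k ≡ + 1 + k₁ →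
  N ≡ v * d + i →
  g ≡ k * k + + 2 - + 3 * k →
  L ≡ k * ((+ 2 * d + + 1) * N) - k * (v * (d * (d + + 1))) →
  P ≡ + 3 * L + E - N * (N * + 2) →
  D₁ ≡ L + k₁ * (L + k * (+ 2 * N + v * (v * v))) - (P + k * (k₁ * (+ 2 * v * N + v * v))) →
  D₂ ≡ E - N * g →
  (k * k - + 3 * k + + 2 * v) * N * N
  - v * (k * (+ 2 * v - + 1) - + 2) * (k - + 1) * N
  + k * (k * (v * v * v * v - v * v * v + v * i - i * i)
         - (v * v * v * v - v * v * v + + 3 * v * i - + 3 * i * i))
  ≡ v * (D₁ + D₂)
discriminant-identity _ _ k₁ v i d _ _ E _ _ _ refl refl refl refl refl refl refl =
  solve (k₁ ∷ v ∷ i ∷ d ∷ E ∷ [])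

a+b≡c⇒a≡c-b : ∀ {a b c : ℤ} → a + b ≡ c → a ≡ c - b
a+b≡c⇒a≡c-b {a} {b} refl = sym (cancel a b)
  where
  cancel : ∀ a b → a + b - b ≡ a
  cancel = solve-∀

a+b≡c⇒b≡c-a : ∀ {a b c : ℤ} → a + b ≡ c → b ≡ c - a
a+b≡c⇒b≡c-a {a} {b} a+b≡c = a+b≡c⇒a≡c-b (trans (ℤ.+-comm b a) a+b≡c)

cast : ∀ {m n : ℕ} {i j : ℤ} → + m ≡ i → + n ≡ j → m ≡ n → i ≡ j
cast +m≡i +n≡j m≡n = trans (sym +m≡i) (trans (cong +_ m≡n) +n≡j)

pos-*³ : ∀ a b c → + (a Data.Nat.* (b Data.Nat.* c)) ≡ + a * (+ b * + c)
pos-*³ a b c = trans (ℤ.pos-* a _) (cong ((+ a) *_) (ℤ.pos-* b c))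

discriminant≡v*slack : ∀ N k₁ v .{{_ : NonZero v}} (C : Array N (suc k₁) v) → IsUCA C →
  let open Agreement C in
  discriminant (+ N) (+ suc k₁) (+ v) (+ (N ∸ v Data.Nat.* (N / v))) ≡ + v * + (squareSlack Data.Nat.+ excessSlack)
discriminant≡v*slack N k₁ v C (isCA , uniform) =
  discriminant-identity (+ N) (+ k) (+ k₁) (+ v) (+ i) (+ d) (+ agreeSum) (+ agreeSqSum) (+ excessSum)
    (+ excess k) (+ squareSlack) (+ excessSlack) refl N≡ g≡ L≡ P≡ D₁≡ D₂≡
  where
  open Agreement C
  k d i : ℕ
  k = suc k₁
  d = N / v
  i = N ∸ v Data.Nat.* d
  N≡ : + N ≡ + v * + d + + i
  N≡ = sym (cast (cong (_+ + i) (ℤ.pos-* v d)) refl (m*[n/m]+[n∸m*[n/m]]≡n v N))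
  g≡ : + excess k ≡ + k * + k + + 2 - + 3 * + k
  g≡ = a+b≡c⇒b≡c-a {a = + 3 * + k}
    (sym (cast (cong (_+ + 2) (ℤ.pos-* k k)) (cong (_+ + excess k) (ℤ.pos-* 3 k)) (a*a+2≡3*a+excess k)))
  L≡ : + agreeSum ≡ + k * ((+ 2 * + d + + 1) * + N) - + k * (+ v * (+ d * (+ d + + 1)))
  L≡ = a+b≡c⇒a≡c-b (cast
    (cong (_+_ (+ agreeSum)) (trans (pos-*³ k v _) (cong (λ z → + k * (+ v * z)) (ℤ.pos-* d (d Data.Nat.+ 1)))))
    (trans (pos-*³ k (2 Data.Nat.* d Data.Nat.+ 1) N) (cong (λ z → + k * ((z + + 1) * + N)) (ℤ.pos-* 2 d)))
    (agreeSum-near-d (occ-near-/ uniform)))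
  P≡ : + agreeSqSum ≡ + 3 * + agreeSum + + excessSum - + N * (+ N * + 2)
  P≡ = a+b≡c⇒a≡c-b (cast (cong (_+_ (+ agreeSqSum)) (pos-*³ N N 2)) (cong (_+ + excessSum) (ℤ.pos-* 3 agreeSum))
    agreeSqSum-excess)
  D₁≡ : + squareSlack ≡ + agreeSum + + k₁ * (+ agreeSum + + k * (+ 2 * + N + + v * (+ v * + v)))
                     - (+ agreeSqSum + + k * (+ k₁ * (+ 2 * + v * + N + + v * + v)))
  D₁≡ = a+b≡c⇒b≡c-a (cast
    (cong (λ z → + agreeSqSum + z + + squareSlack) (trans (pos-*³ k k₁ _) (cong (λ z → + k * (+ k₁ * z))
      (cong₂ _+_ (trans (ℤ.pos-* (2 Data.Nat.* v) N) (cong (_* + N) (ℤ.pos-* 2 v))) (ℤ.pos-* v v)))))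
    (cong (_+_ (+ agreeSum)) (trans (ℤ.pos-* k₁ _) (cong (λ z → + k₁ * (+ agreeSum + z))
      (trans (ℤ.pos-* k _) (cong ((+ k) *_) (cong₂ _+_ (ℤ.pos-* 2 N) (pos-*³ v v v)))))))
    (agreeSqSum+squareSlack isCA))
  D₂≡ : + excessSlack ≡ + excessSum - + N * + excess k
  D₂≡ = a+b≡c⇒b≡c-a {a = + N * + excess k}
    (cast (cong (_+ + excessSlack) (ℤ.pos-* N (excess k))) refl excessSum≡+excessSlack)

theorem1 : (N k v : ℕ) → 1 ≤ N → 2 ≤ k → 2 ≤ v → .{{_ : NonZero v}} →
    (C : Array N k v) → IsUCA C →
    let d = N / v
        i = N ∸ v Data.Nat.* d
        N' = + N
        k' = + k
        v' = + v
        i' = + i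
        lhs = (k' * k' - + 3 * k' + + 2 * v') * N' * N'
              - v' * (k' * (+ 2 * v' - + 1) - + 2) * (k' - + 1) * N'
              + k' * (k' * (v' * v' * v' * v' - v' * v' * v' + v' * i' - i' * i')
                      - (v' * v' * v' * v' - v' * v' * v' + + 3 * v' * i' - + 3 * i' * i'))
    in (lhs ≥ + 0)
       × (lhs ≡ + 0 → (r r' : Fin N) → ¬ (r ≡ r') → (1 ≤ agree C r r') × (agree C r r' ≤ 2))
theorem1 N (suc k₁) v _ _ _ C isUCA = Δ≥0 , agree-1-2
  where
  open Agreement C
  Δ : ℤ
  Δ = discriminant (+ N) (+ suc k₁) (+ v) (+ (N ∸ v Data.Nat.* (N / v)))
  Δ≡v*slack : Δ ≡ + (v Data.Nat.* (squareSlack Data.Nat.+ excessSlack))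
  Δ≡v*slack = trans (discriminant≡v*slack N k₁ v C isUCA) (sym (ℤ.pos-* v _))
  Δ≥0 : Δ ≥ + 0
  Δ≥0 = subst (_≥ + 0) (sym Δ≡v*slack) (Data.Integer.+≤+ Data.Nat.z≤n)
  agree-1-2 : Δ ≡ + 0 → ∀ r r' → ¬ (r ≡ r') → 1 ≤ agree C r r' × agree C r r' ≤ 2
  agree-1-2 Δ≡0 _ _ = excessSlack≡0⇒agree-1-2 (ℕ.m+n≡0⇒n≡0 squareSlack slack≡0)
    where
    slack≡0 : squareSlack Data.Nat.+ excessSlack ≡ 0
    slack≡0 = ℕ.m*n≡0⇒m≡0 _ v (trans (ℕ.*-comm _ v) (ℤ.+-injective (trans (sym Δ≡v*slack) Δ≡0)))
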